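{- Let $l\ge 3$ and $k\ge 1$. Let $(G_l,\sigma)$ be the signed graph obtained from a negative cycle of length $l$ (a cycle whose product of edge signs is negative) by adding, for each edge $uv$ of the cycle, a new vertex $w_{uv}$ adjacent to $u$ and $v$, such that each triangle $uvw_{uv}$ is positive. Then $(G_l,\sigma)$ does not admit a homomorphism to $(K_{2k},M)$.
   Context: A signed graph is a simple graph with a signature $\sigma:E\to\{+,-\}$; the sign of a cycle or closed walk is the product of the signs of its edges (with multiplicity). A homomorphism of $(G,\sigma)$ to $(H,\pi)$ maps vertices and edges of $G$ to vertices and edges of $H$ preserving adjacencies, incidences and signs of closed walks. $(K_{2k},M)$ is the complete graph on $2k$ vertices in which the edges of a perfect matching $M$ are negative and all other edges are positive. -}

module Defs where

open import Data.Nat using (ℕ; zero; suc; _%_)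
open import Data.Nat.DivMod using (m%n<n)
open import Data.Fin using (Fin; toℕ; fromℕ<) renaming (_≟_ to _≟ᶠ_)
open import Data.Bool using (Bool; true; false; _∨_; not; if_then_else_)
open import Data.Bool.Properties using () renaming (_≟_ to _≟ᵇ_)
open import Data.Product using (_×_; _,_)
open import Data.Sum using (_⊎_; inj₁; inj₂)
open import Data.List using (List; []; _∷_; _∷ʳ_; map)
open import Data.Unit using (⊤)
open import Relation.Nullary.Decidable using (⌊_⌋)
open import Relation.Binary.PropositionalEquality using (_≡_)

data Sign : Set where
  pos neg : Sign

_·_ : Sign → Sign → Sign
pos · s = s
neg · pos = neg
neg · neg = pos

-- A signed graph: vertex set, (Boolean) adjacency, and a sign on each
-- pair of vertices (only meaningful on edges).
record SignedGraph : Set₁ where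
  field
    V   : Set
    adj : V → V → Bool
    sig : V → V → Sign
open SignedGraph public

module _ (G : SignedGraph) where
  IsWalk : List (V G) → Set
  IsWalk [] = ⊤
  IsWalk (x ∷ []) = ⊤
  IsWalk (x ∷ y ∷ r) = (adj G x y ≡ true) × IsWalk (y ∷ r)

  walkSign : List (V G) → Sign
  walkSign [] = pos
  walkSign (x ∷ []) = pos
  walkSign (x ∷ y ∷ r) = sig G x y · walkSign (y ∷ r)

closedWalk : {A : Set} → A → List A → List A
closedWalk v vs = v ∷ (vs ∷ʳ v)

-- Homomorphism of signed graphs (simple graphs, so the edge map is
-- determined by the vertex map): preserves adjacency and the signs of
-- all closed walks.
record Hom (G H : SignedGraph) : Set where
  field
    f        : V G → V H
    adj-pres : ∀ u v → adj G u v ≡ true → adj H (f u) (f v) ≡ true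
    sign-pres : ∀ v vs → IsWalk G (closedWalk v vs) →
                walkSign H (map f (closedWalk v vs)) ≡ walkSign G (closedWalk v vs)

-- (K_{2k}, M): vertices (i , b) with i : Fin k, b : Bool (2k vertices);
-- all distinct vertices adjacent; the perfect matching
-- M = { (i,false)(i,true) } is negative, all other edges positive.
K2kM : ℕ → SignedGraph
K2kM k = record
  { V   = Fin k × Bool
  ; adj = λ { (i , b) (j , c) → not (⌊ i ≟ᶠ j ⌋ Data.Bool.∧ ⌊ b ≟ᵇ c ⌋) }
  ; sig = λ { (i , b) (j , c) → if ⌊ i ≟ᶠ j ⌋ then neg else pos }
  }

next : ∀ {l} → Fin l → Fin l
next {suc n} i = fromℕ< (m%n<n (suc (toℕ i)) (suc n))

prodFin : ∀ {l} → (Fin l → Sign) → Sign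
prodFin {zero} c = pos
prodFin {suc l} c = c Fin.zero · prodFin (λ i → c (Fin.suc i))
  where import Data.Fin as Fin

-- The graph G_l: vertices inj₁ i = u_i (cycle vertices u_0 … u_{l-1},
-- with cycle edges u_i u_{next i}) and inj₂ i = w_i, the new vertex
-- attached to the edge u_i u_{next i}.
-- Signature: c i = sign of u_i u_{next i}, a i = sign of w_i u_i,
-- b i = sign of w_i u_{next i}.
Gl : (l : ℕ) → (c a b : Fin l → Sign) → SignedGraph
Gl l c a b = record
  { V   = Fin l ⊎ Fin l
  ; adj = A
  ; sig = S
  }
  where
  A : Fin l ⊎ Fin l → Fin l ⊎ Fin l → Bool
  A (inj₁ i) (inj₁ j) = ⌊ j ≟ᶠ next i ⌋ ∨ ⌊ i ≟ᶠ next j ⌋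
  A (inj₁ i) (inj₂ e) = ⌊ i ≟ᶠ e ⌋ ∨ ⌊ i ≟ᶠ next e ⌋
  A (inj₂ e) (inj₁ i) = ⌊ i ≟ᶠ e ⌋ ∨ ⌊ i ≟ᶠ next e ⌋
  A (inj₂ e) (inj₂ e') = false
  S : Fin l ⊎ Fin l → Fin l ⊎ Fin l → Sign
  S (inj₁ i) (inj₁ j) = if ⌊ j ≟ᶠ next i ⌋ then c i else c j
  S (inj₁ i) (inj₂ e) = if ⌊ i ≟ᶠ e ⌋ then a e else b e
  S (inj₂ e) (inj₁ i) = if ⌊ i ≟ᶠ e ⌋ then a e else b e
  S (inj₂ e) (inj₂ e') = pos

-- A homomorphism φ maps each positive triangle u_i u_{i+1} w_i onto a
-- positive triangle of (K_{2k}, M).  A triangle of (K_{2k}, M) through a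
-- matching edge has exactly one negative edge, so positive triangles avoid M;
-- hence φ sends every cycle edge u_i u_{i+1} to a positive edge.  The image
-- of the negative cycle u_0 … u_{l-1} u_0 is then a positive closed walk,
-- contradicting preservation of closed-walk signs.
module Submission where

open import Defs
open import Data.Nat using (ℕ; _≤_; zero; suc; s≤s; _%_)
open import Data.Nat.Properties using (1+n≢n)
open import Data.Nat.DivMod using (m<n⇒m%n≡m; n%n≡0)
open import Data.Fin using (Fin; toℕ; fromℕ; inject₁) renaming (_≟_ to _≟ᶠ_)
import Data.Fin as Fin
open import Data.Fin.Properties using (0≢1+n; toℕ-fromℕ<; toℕ-inject₁; toℕ-injective; toℕ-fromℕ; toℕ<n)
open import Data.Fin.Relation.Unary.Top using (view; ‵fromℕ; ‵inject₁)
open import Data.Empty using (⊥; ⊥-elim)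
open import Data.Unit using (tt)
open import Data.Bool using (true; false; not)
open import Data.Bool.Properties using (∨-zeroʳ) renaming (_≟_ to _≟ᵇ_)
open import Data.Product using (_,_)
open import Data.Sum using (inj₁; inj₂)
open import Data.List using (List; []; _∷_; _∷ʳ_; [_]; map; foldr; tabulate; allFin)
open import Data.List.Properties using (map-++; map-tabulate)
open import Data.List.Relation.Unary.Linked using (Linked; []; [-]; _∷_)
import Data.List.Relation.Unary.Linked as Linked
open import Data.List.Relation.Unary.Linked.Properties using (map⁺)
open import Relation.Nullary using (Dec; ¬_; yes; no)
open import Relation.Nullary.Decidable using (⌊_⌋; isYes≗does; dec-true; dec-false)
open import Relation.Binary.PropositionalEquality
  using (_≡_; _≢_; refl; sym; trans; cong; cong₂; subst; module ≡-Reasoning)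

⌊⌋-true : ∀ {A : Set} (a? : Dec A) → A → ⌊ a? ⌋ ≡ true
⌊⌋-true a? a = trans (isYes≗does a?) (dec-true a? a)

⌊⌋-false : ∀ {A : Set} (a? : Dec A) → ¬ A → ⌊ a? ⌋ ≡ false
⌊⌋-false a? ¬a = trans (isYes≗does a?) (dec-false a? ¬a)

pos≢neg : pos ≢ neg
pos≢neg ()

·-identityʳ : ∀ s → s · pos ≡ s
·-identityʳ pos = refl
·-identityʳ neg = refl

·-comm : ∀ s t → s · t ≡ t · s
·-comm pos t = sym (·-identityʳ t)
·-comm neg pos = refl
·-comm neg neg = refl

·-assoc : ∀ s t u → (s · t) · u ≡ s · (t · u)
·-assoc pos t u = refl
·-assoc neg pos u = refl
·-assoc neg neg pos = refl
·-assoc neg neg neg = refl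

next-inject₁ : ∀ {n} (j : Fin n) → next (inject₁ j) ≡ Fin.suc j
next-inject₁ {n} j = toℕ-injective (begin
  toℕ (next (inject₁ j))         ≡⟨ toℕ-fromℕ< _ ⟩
  suc (toℕ (inject₁ j)) % suc n  ≡⟨ cong (λ t → suc t % suc n) (toℕ-inject₁ j) ⟩
  suc (toℕ j) % suc n            ≡⟨ m<n⇒m%n≡m (s≤s (toℕ<n j)) ⟩
  suc (toℕ j)                    ∎)
  where open ≡-Reasoning

next-fromℕ : ∀ n → next (fromℕ n) ≡ Fin.zero
next-fromℕ n = toℕ-injective (begin
  toℕ (next (fromℕ n))         ≡⟨ toℕ-fromℕ< _ ⟩
  suc (toℕ (fromℕ n)) % suc n  ≡⟨ cong (λ t → suc t % suc n) (toℕ-fromℕ n) ⟩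
  suc n % suc n                ≡⟨ n%n≡0 (suc n) ⟩
  0                            ∎)
  where open ≡-Reasoning

next-≢ : ∀ {n} (i : Fin (suc (suc n))) → next i ≢ i
next-≢ i with view i
... | ‵fromℕ     = λ eq → 0≢1+n (trans (sym (next-fromℕ _)) eq)
... | ‵inject₁ j = λ eq → 1+n≢n (trans (cong toℕ (trans (sym (next-inject₁ j)) eq)) (toℕ-inject₁ j))

Linked-tabulate-∷ʳ : ∀ {A : Set} {R : A → A → Set} {m} (g : Fin (suc m) → A) {z : A} →
  (∀ j → R (g (inject₁ j)) (g (Fin.suc j))) → R (g (fromℕ m)) z →
  Linked R (tabulate g ∷ʳ z)
Linked-tabulate-∷ʳ {m = zero}  g step last = last ∷ [-]
Linked-tabulate-∷ʳ {m = suc m} g step last =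
  step Fin.zero ∷ Linked-tabulate-∷ʳ (λ i → g (Fin.suc i)) (λ j → step (Fin.suc j)) last

map-closedWalk : ∀ {A B : Set} (g : A → B) v vs → map g (closedWalk v vs) ≡ closedWalk (g v) (map g vs)
map-closedWalk g v vs = cong (g v ∷_) (map-++ g vs [ v ])

module _ (G : SignedGraph) where

  Linked⇒IsWalk : ∀ {xs} → Linked (λ x y → adj G x y ≡ true) xs → IsWalk G xs
  Linked⇒IsWalk []          = tt
  Linked⇒IsWalk [-]         = tt
  Linked⇒IsWalk (xy ∷ rest) = xy , Linked⇒IsWalk rest

  walkSign-positive : ∀ {xs} → Linked (λ x y → sig G x y ≡ pos) xs → walkSign G xs ≡ pos
  walkSign-positive []          = refl
  walkSign-positive [-]         = refl
  walkSign-positive (xy ∷ rest) = cong₂ _·_ xy (walkSign-positive rest)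

  walkSign-map-∷ʳ : ∀ {A : Set} (g : A → V G) (s : A → Sign) xs {z} →
    Linked (λ x y → sig G (g x) (g y) ≡ s x) (xs ∷ʳ z) →
    walkSign G (map g (xs ∷ʳ z)) ≡ foldr _·_ pos (map s xs)
  walkSign-map-∷ʳ g s []           _            = refl
  walkSign-map-∷ʳ g s (x ∷ [])     (xz ∷ [-])   = cong (_· pos) xz
  walkSign-map-∷ʳ g s (x ∷ y ∷ xs) (xy ∷ rest)  = cong₂ _·_ xy (walkSign-map-∷ʳ g s (y ∷ xs) rest)

isWalk-map : ∀ {G H} (h : Hom G H) {xs} → IsWalk G xs → IsWalk H (map (Hom.f h) xs)
isWalk-map h {[]}         _           = tt
isWalk-map h {x ∷ []}     _           = tt
isWalk-map h {x ∷ y ∷ xs} (xy , rest) = Hom.adj-pres h x y xy , isWalk-map h rest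

prodFin-tabulate : ∀ {n} (c : Fin n → Sign) → prodFin c ≡ foldr _·_ pos (tabulate c)
prodFin-tabulate {zero}  c = refl
prodFin-tabulate {suc n} c = cong (c Fin.zero ·_) (prodFin-tabulate (λ i → c (Fin.suc i)))

no-three-distinct-Bool : ∀ b b′ b″ →
  not ⌊ b ≟ᵇ b′ ⌋ ≡ true → not ⌊ b′ ≟ᵇ b″ ⌋ ≡ true → not ⌊ b″ ≟ᵇ b ⌋ ≡ true → ⊥
no-three-distinct-Bool false false _     () _  _
no-three-distinct-Bool true  true  _     () _  _
no-three-distinct-Bool false true  false _  _  ()
no-three-distinct-Bool false true  true  _  () _
no-three-distinct-Bool true  false false _  () _
no-three-distinct-Bool true  false true  _  _  ()

K2kM-positive-triangle⇒positive-edge : ∀ {k} (x y z : V (K2kM k)) →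
  IsWalk (K2kM k) (closedWalk x (y ∷ z ∷ [])) →
  walkSign (K2kM k) (closedWalk x (y ∷ z ∷ [])) ≡ pos →
  sig (K2kM k) x y ≡ pos
K2kM-positive-triangle⇒positive-edge (i , b) (j , b′) (m , b″) (xy , yz , zx , _) s
  with i ≟ᶠ j | j ≟ᶠ m | m ≟ᶠ i
... | no _  | _     | _     = refl
... | yes p | yes q | no r  = ⊥-elim (r (sym (trans p q)))
... | yes p | no q  | yes r = ⊥-elim (q (sym (trans r p)))
... | yes _ | no _  | no _  = ⊥-elim (pos≢neg (sym s))
... | yes _ | yes _ | yes _ = ⊥-elim (no-three-distinct-Bool b b′ b″ xy yz zx)

cycle : ∀ m → List (Fin (suc m))
cycle m = allFin (suc m) ∷ʳ Fin.zero

cycle-next : ∀ m → Linked (λ i j → next i ≡ j) (cycle m)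
cycle-next m = Linked-tabulate-∷ʳ (λ i → i) next-inject₁ (next-fromℕ m)

module _ {m} (c a b : Fin (suc m) → Sign) where
  private
    G = Gl (suc m) c a b

  triangle : Fin (suc m) → List (V G)
  triangle i = closedWalk (inj₁ i) (inj₁ (next i) ∷ inj₂ i ∷ [])

  triangle-isWalk : ∀ i → IsWalk G (triangle i)
  triangle-isWalk i rewrite ⌊⌋-true (next i ≟ᶠ next i) refl | ⌊⌋-true (i ≟ᶠ i) refl =
    refl , ∨-zeroʳ _ , refl , tt

  cycle-edge-adj : ∀ i → adj G (inj₁ i) (inj₁ (next i)) ≡ true
  cycle-edge-adj i rewrite ⌊⌋-true (next i ≟ᶠ next i) refl = refl

  cycle-edge-sig : ∀ i → sig G (inj₁ i) (inj₁ (next i)) ≡ c i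
  cycle-edge-sig i rewrite ⌊⌋-true (next i ≟ᶠ next i) refl = refl

  cycleWalk : List (V G)
  cycleWalk = map inj₁ (cycle m)

  cycle-isWalk : IsWalk G cycleWalk
  cycle-isWalk = Linked⇒IsWalk G (map⁺ (Linked.map (λ { {i} refl → cycle-edge-adj i }) (cycle-next m)))

  cycle-sign : walkSign G cycleWalk ≡ prodFin c
  cycle-sign = begin
    walkSign G cycleWalk
      ≡⟨ walkSign-map-∷ʳ G inj₁ c (allFin (suc m)) (Linked.map (λ { {i} refl → cycle-edge-sig i }) (cycle-next m)) ⟩
    foldr _·_ pos (map c (allFin (suc m)))  ≡⟨ cong (foldr _·_ pos) (map-tabulate (λ i → i) c) ⟩
    foldr _·_ pos (tabulate c)               ≡⟨ sym (prodFin-tabulate c) ⟩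
    prodFin c                                ∎
    where open ≡-Reasoning

  cycleWalk-closed : cycleWalk ≡ closedWalk (inj₁ Fin.zero) (map inj₁ (tabulate Fin.suc))
  cycleWalk-closed = map-closedWalk inj₁ Fin.zero (tabulate Fin.suc)

triangle-sign : ∀ {n} (c a b : Fin (suc (suc n)) → Sign) i →
  walkSign (Gl _ c a b) (triangle c a b i) ≡ (c i · a i) · b i
triangle-sign c a b i
  rewrite ⌊⌋-true (next i ≟ᶠ next i) refl | ⌊⌋-false (next i ≟ᶠ i) (next-≢ i) | ⌊⌋-true (i ≟ᶠ i) refl =
  begin
    c i · (b i · (a i · pos))  ≡⟨ cong (λ t → c i · (b i · t)) (·-identityʳ (a i)) ⟩
    c i · (b i · a i)          ≡⟨ cong (c i ·_) (·-comm (b i) (a i)) ⟩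
    c i · (a i · b i)          ≡⟨ sym (·-assoc (c i) (a i) (b i)) ⟩
    (c i · a i) · b i          ∎
  where open ≡-Reasoning

module _ {n k} {c a b : Fin (suc (suc n)) → Sign} (h : Hom (Gl _ c a b) (K2kM k)) where
  open Hom h
  private
    G = Gl _ c a b
    K = K2kM k

  cycle-edge-positive : (∀ i → (c i · a i) · b i ≡ pos) →
    ∀ i → sig K (f (inj₁ i)) (f (inj₁ (next i))) ≡ pos
  cycle-edge-positive triangles-pos i =
    K2kM-positive-triangle⇒positive-edge _ _ _
      (isWalk-map h {triangle c a b i} (triangle-isWalk c a b i)) (begin
      walkSign K (map f (triangle c a b i))
        ≡⟨ sign-pres (inj₁ i) (inj₁ (next i) ∷ inj₂ i ∷ []) (triangle-isWalk c a b i) ⟩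
      walkSign G (triangle c a b i)          ≡⟨ triangle-sign c a b i ⟩
      (c i · a i) · b i                      ≡⟨ triangles-pos i ⟩
      pos                                    ∎)
    where open ≡-Reasoning

  cycle-image-positive : (∀ i → (c i · a i) · b i ≡ pos) →
    walkSign K (map f (cycleWalk c a b)) ≡ pos
  cycle-image-positive triangles-pos = walkSign-positive K
    (map⁺ (map⁺ (Linked.map (λ { {i} refl → cycle-edge-positive triangles-pos i }) (cycle-next _))))

  cycle-sign-preserved : walkSign K (map f (cycleWalk c a b)) ≡ walkSign G (cycleWalk c a b)
  cycle-sign-preserved =
    subst (λ γ → walkSign K (map f γ) ≡ walkSign G γ) (sym (cycleWalk-closed c a b))
      (sign-pres (inj₁ Fin.zero) (map inj₁ (tabulate Fin.suc))
        (subst (IsWalk G) (cycleWalk-closed c a b) (cycle-isWalk c a b)))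

proposition7p2 : (l k : ℕ) → 3 ≤ l → 1 ≤ k →
    (c a b : Fin l → Sign) →
    prodFin c ≡ neg →
    (∀ i → (c i · a i) · b i ≡ pos) →
    Hom (Gl l c a b) (K2kM k) → ⊥
proposition7p2 (suc (suc (suc n))) k (s≤s (s≤s (s≤s _))) _ c a b cycle-neg triangles-pos h =
  pos≢neg (begin
    pos                                                  ≡⟨ sym (cycle-image-positive h triangles-pos) ⟩
    walkSign (K2kM k) (map (Hom.f h) (cycleWalk c a b))  ≡⟨ cycle-sign-preserved h ⟩
    walkSign (Gl _ c a b) (cycleWalk c a b)              ≡⟨ cycle-sign c a b ⟩
    prodFin c                                            ≡⟨ cycle-neg ⟩
    neg                                                  ∎)
  where open ≡-Reasoning
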